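{- Let $N \ge 1$ be an integer, let $i_1, \ldots, i_N, D \in \mathbb{N}_0$, $A \in \mathbb{N}_+$, $\kappa_1, \ldots, \kappa_N \in \mathbb{N}_0$, and $i = \sum_{n=1}^{N} i_n$. Set $\tilde{\Delta}_0 = 0$ and, for $n = 1, \ldots, N$, $$(j_n, \tilde{\Delta}_n) = \mathrm{ds}(i_n, D, A, \kappa_n, \tilde{\Delta}_{n-1}).$$ Then $j = \sum_{n=1}^{N} j_n$ is a nearest integer solution to $i\frac{D}{A}$ and $\tilde{\Delta}_N = jA - iD$.
   Context: $\mathbb{N}_0$ denotes the set of non-negative integers and $\mathbb{N}_+$ the set of positive integers. Given $i, D \in \mathbb{N}_0$ and $A \in \mathbb{N}_+$, an integer $j \in \mathbb{N}_0$ is called a nearest integer solution to $i\frac{D}{A}$ if $j \in \arg\min_{k \in \mathbb{N}_0} \left| k - i\frac{D}{A} \right|$ (there may be up to two such $j$). For $x \in \mathbb{N}_0$, $x \bmod A \in \{0,\ldots,A-1\}$ is the remainder on division by $A$. The function $\mathrm{ds}(i, D, A, k_0, \Delta_-)$, with integer inputs $k_0$ and $\Delta_-$, returns a pair of integers computed as follows. Set $\Delta_0 := (k_0 - i)A + i(A - D) + \Delta_-$. Case 1: if $\Delta_0 = 0$, return $(k_0, \Delta_0)$. Case 2: if $\Delta_0 > 0$, set $k_1 := k_0 - \lfloor \Delta_0 / A \rfloor$ and $\Delta_1 := \Delta_0 \bmod A$; if $|\Delta_1 - A| < |\Delta_1|$ return $(k_1 - 1, \Delta_1 - A)$, otherwise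 return $(k_1, \Delta_1)$. Case 3: if $\Delta_0 < 0$, set $k_1 := k_0 + \lfloor |\Delta_0| / A \rfloor$ and $\Delta_1 := -(|\Delta_0| \bmod A)$; if $|\Delta_1 + A| < |\Delta_1|$ return $(k_1 + 1, \Delta_1 + A)$, otherwise return $(k_1, \Delta_1)$. -}

module Defs where

open import Data.Nat as ℕ using (ℕ; zero; suc; NonZero; _<ᵇ_)
open import Data.Nat.DivMod using (_/_; _%_)
open import Data.Integer as ℤ using (ℤ; +_; -[1+_]; 0ℤ; 1ℤ)
open import Data.Rational as ℚ using (ℚ)
open import Data.Bool using (if_then_else_)
open import Data.Product using (Σ; _×_; _,_)
open import Data.Vec using (Vec; []; _∷_)
open import Relation.Binary.PropositionalEquality using (_≡_)

ratio : (i D A : ℕ) → .{{_ : NonZero A}} → ℚ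
ratio i D A = (+ (i ℕ.* D)) ℚ./ A

ℕtoℚ : ℕ → ℚ
ℕtoℚ k = (+ k) ℚ./ 1

IsNearestℕ : (i D A : ℕ) → .{{_ : NonZero A}} → ℕ → Set
IsNearestℕ i D A j =
  (k : ℕ) → ℚ.∣ ℕtoℚ j ℚ.- ratio i D A ∣ ℚ.≤ ℚ.∣ ℕtoℚ k ℚ.- ratio i D A ∣

IsNearestIntegerSolution : (i D A : ℕ) → .{{_ : NonZero A}} → ℤ → Set
IsNearestIntegerSolution i D A j = Σ ℕ (λ j′ → (j ≡ + j′) × IsNearestℕ i D A j′)

dsCase : (A : ℕ) → .{{_ : NonZero A}} → (k₀ Δ₀ : ℤ) → ℤ × ℤ
dsCase A k₀ (+ zero) = k₀ , + zero
dsCase A k₀ (+ (suc m)) =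
  let k₁ = k₀ ℤ.- + (suc m / A)
      Δ₁ = + (suc m % A)
  in if ℤ.∣ Δ₁ ℤ.- + A ∣ <ᵇ ℤ.∣ Δ₁ ∣
       then (k₁ ℤ.- 1ℤ , Δ₁ ℤ.- + A)
       else (k₁ , Δ₁)
dsCase A k₀ -[1+ m ] =
  let k₁ = k₀ ℤ.+ + (suc m / A)
      Δ₁ = ℤ.- (+ (suc m % A))
  in if ℤ.∣ Δ₁ ℤ.+ + A ∣ <ᵇ ℤ.∣ Δ₁ ∣
       then (k₁ ℤ.+ 1ℤ , Δ₁ ℤ.+ + A)
       else (k₁ , Δ₁)

ds : (i D A : ℕ) → .{{_ : NonZero A}} → (k₀ Δ₋ : ℤ) → ℤ × ℤ
ds i D A k₀ Δ₋ =
  dsCase A k₀ ((k₀ ℤ.- + i) ℤ.* + A ℤ.+ + i ℤ.* (+ A ℤ.- + D) ℤ.+ Δ₋)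

dsSeq : ∀ {N} (D A : ℕ) → .{{_ : NonZero A}} → (is κs : Vec ℕ N) → ℤ → Vec ℤ N × ℤ
dsSeq D A [] [] Δ = [] , Δ
dsSeq D A (i ∷ is) (κ ∷ κs) Δ with ds i D A (+ κ) Δ
... | (j , Δ′) with dsSeq D A is κs Δ′
...   | (js , Δ″) = (j ∷ js) , Δ″

sumℤ : ∀ {N} → Vec ℤ N → ℤ
sumℤ [] = 0ℤ
sumℤ (x ∷ xs) = x ℤ.+ sumℤ xs

-- Each step of ds keeps Δ − kA equal to Δ₋ − iD (it only trades multiples of A
-- between k and Δ) and, of the two remainders of Δ₀ modulo A, keeps the one of
-- least absolute value, so that 2|Δ| ≤ A.  Telescoping over the steps gives
-- Δ̃_N = jA − iD with 2|jA − iD| ≤ A.  Such a j is a nearest integer to iD/A: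
-- for k ≠ j, |kA − iD| ≥ |k − j|A − |jA − iD| ≥ A − |jA − iD| ≥ |jA − iD|.
-- It is non-negative, since j < 0 would give |jA − iD| ≥ A.
module Submission where

open import Defs
open import Data.Nat using (ℕ; _≤_; NonZero)
open import Data.Integer using (ℤ; +_; _*_; _-_; 0ℤ)
open import Data.Vec using (Vec; sum)
open import Data.Product using (_×_; proj₁; proj₂)
open import Relation.Binary.PropositionalEquality using (_≡_)

open import Data.Bool using (true; false; T; if_then_else_)
open import Data.Empty using (⊥-elim)
open import Data.Integer using (-[1+_]; _+_; -_; ∣_∣; 1ℤ)
import Data.Integer as ℤ
open import Data.Integer.Tactic.RingSolver using (solve-∀)
open import Data.Nat.DivMod using (_/_; _%_; m≡m%n+[m/n]*n; m%n<n)
open import Data.Product using (Σ; _,_; map₁)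
open import Data.Unit using (tt)
open import Data.Vec using ([]; _∷_)
open import Relation.Binary.PropositionalEquality
  using (_≢_; refl; sym; trans; cong; cong₂; subst; module ≡-Reasoning)
open import Relation.Nullary using (yes; no)

import Data.Nat as ℕ
import Data.Nat.Properties as ℕₚ
import Data.Integer.Properties as ℤₚ
import Data.Rational as ℚ
import Data.Rational.Properties as ℚₚ
import Data.Rational.Unnormalised as ℚᵘ
import Data.Rational.Unnormalised.Properties as ℚᵘₚ

Centred : ℕ → ℤ → Set
Centred A Δ = 2 ℕ.* ∣ Δ ∣ ≤ A

m≤n⇒2*m≤m+n : ∀ {m n} → m ≤ n → 2 ℕ.* m ≤ m ℕ.+ n
m≤n⇒2*m≤m+n {m} m≤n = ℕₚ.+-monoʳ-≤ m (ℕₚ.≤-trans (ℕₚ.≤-reflexive (ℕₚ.+-identityʳ m)) m≤n)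

2*m≤n⇒m<n : ∀ {m n} .{{_ : NonZero n}} → 2 ℕ.* m ≤ n → m ℕ.< n
2*m≤n⇒m<n {ℕ.zero}  {n} _   = ℕ.>-nonZero⁻¹ n
2*m≤n⇒m<n {ℕ.suc m}     2m≤n = ℕₚ.<-≤-trans (ℕₚ.m<m+n (ℕ.suc m) ℕ.z<s) 2m≤n

∣+m-+n∣≡n∸m : ∀ {m n} → m ≤ n → ∣ + m - + n ∣ ≡ n ℕ.∸ m
∣+m-+n∣≡n∸m {m} {n} m≤n = trans (cong ∣_∣ (ℤₚ.[+m]-[+n]≡m⊖n m n)) (ℤₚ.∣⊖∣-≤ m≤n)

∣-+m++n∣≡n∸m : ∀ {m n} → m ≤ n → ∣ - + m + + n ∣ ≡ n ℕ.∸ m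
∣-+m++n∣≡n∸m {m} {n} m≤n = cong ∣_∣ (trans (ℤₚ.-m+n≡n⊖m m n) (ℤₚ.≤-⊖ m≤n))

+n≡+[n%A]++[n/A]*+A : ∀ n A .{{_ : NonZero A}} → + n ≡ + (n % A) + + (n / A) * + A
+n≡+[n%A]++[n/A]*+A n A = begin
  + n                               ≡⟨ cong +_ (m≡m%n+[m/n]*n n A) ⟩
  + (n % A ℕ.+ n / A ℕ.* A)         ≡⟨ ℤₚ.pos-+ (n % A) (n / A ℕ.* A) ⟩
  + (n % A) + + (n / A ℕ.* A)       ≡⟨ cong (_+_ (+ (n % A))) (ℤₚ.pos-* (n / A) A) ⟩
  + (n % A) + + (n / A) * + A       ∎
  where open ≡-Reasoning

i≢j⇒n≤∣[i-j]*n∣ : ∀ {i j} n → i ≢ j → n ≤ ∣ (i - j) * + n ∣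
i≢j⇒n≤∣[i-j]*n∣ {i} {j} n i≢j =
  subst (n ≤_) (sym (ℤₚ.∣i*j∣≡∣i∣*∣j∣ (i - j) (+ n))) (ℕₚ.m≤n*m n ∣ i - j ∣ {{∣i-j∣≢0}})
  where
  ∣i-j∣≢0 : NonZero ∣ i - j ∣
  ∣i-j∣≢0 = ℕ.≢-nonZero (λ ∣i-j∣≡0 → i≢j (ℤₚ.i-j≡0⇒i≡j i j (ℤₚ.∣i∣≡0⇒i≡0 ∣i-j∣≡0)))

i-j≡0-k⇒i≡j-k : ∀ {i j k} → i - j ≡ 0ℤ - k → i ≡ j - k
i-j≡0-k⇒i≡j-k {i} {j} {k} eq = begin
  i             ≡⟨ cancel i j ⟩
  (i - j) + j   ≡⟨ cong (_+ j) eq ⟩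
  (0ℤ - k) + j  ≡⟨ reorder j k ⟩
  j - k         ∎
  where
  open ≡-Reasoning
  cancel : ∀ i j → i ≡ (i - j) + j
  cancel = solve-∀
  reorder : ∀ j k → (0ℤ - k) + j ≡ j - k
  reorder = solve-∀

nearer-centred : ∀ {A} {k l : ℤ} x y → ∣ x ∣ ℕ.+ ∣ y ∣ ≡ A →
  Centred A (proj₂ (if ∣ y ∣ ℕ.<ᵇ ∣ x ∣ then (l , y) else (k , x)))
nearer-centred x y refl with ∣ y ∣ ℕ.<ᵇ ∣ x ∣ in y<ᵇx
... | true  = subst (2 ℕ.* ∣ y ∣ ≤_) (ℕₚ.+-comm ∣ y ∣ ∣ x ∣)
                (m≤n⇒2*m≤m+n (ℕₚ.<⇒≤ (ℕₚ.<ᵇ⇒< ∣ y ∣ ∣ x ∣ (subst T (sym y<ᵇx) tt))))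
... | false = m≤n⇒2*m≤m+n {∣ x ∣} (ℕₚ.≮⇒≥ (λ y<x → subst T y<ᵇx (ℕₚ.<⇒<ᵇ y<x)))

dsCase-centred : ∀ A .{{_ : NonZero A}} k₀ Δ₀ → Centred A (proj₂ (dsCase A k₀ Δ₀))
dsCase-centred A k₀ (+ ℕ.zero)  = ℕ.z≤n
dsCase-centred A k₀ (+ ℕ.suc m) =
  nearer-centred (+ r) (+ r - + A)
    (trans (cong (r ℕ.+_) (∣+m-+n∣≡n∸m r≤A)) (ℕₚ.m+[n∸m]≡n r≤A))
  where
  r = ℕ.suc m % A
  r≤A = ℕₚ.<⇒≤ (m%n<n (ℕ.suc m) A)
dsCase-centred A k₀ -[1+ m ] =
  nearer-centred (- + r) (- + r + + A)
    (trans (cong₂ ℕ._+_ (ℤₚ.∣-i∣≡∣i∣ (+ r)) (∣-+m++n∣≡n∸m r≤A)) (ℕₚ.m+[n∸m]≡n r≤A))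
  where
  r = ℕ.suc m % A
  r≤A = ℕₚ.<⇒≤ (m%n<n (ℕ.suc m) A)

excess : ℕ → ℤ × ℤ → ℤ
excess A (k , Δ) = Δ - k * + A

excess-borrow : ∀ A b k Δ → excess A (if b then (k - 1ℤ , Δ - + A) else (k , Δ)) ≡ excess A (k , Δ)
excess-borrow A true  k Δ = lemma k Δ (+ A)
  where
  lemma : ∀ k Δ A → (Δ - A) - (k - 1ℤ) * A ≡ Δ - k * A
  lemma = solve-∀
excess-borrow A false k Δ = refl

excess-carry : ∀ A b k Δ → excess A (if b then (k + 1ℤ , Δ + + A) else (k , Δ)) ≡ excess A (k , Δ)
excess-carry A true  k Δ = lemma k Δ (+ A)
  where
  lemma : ∀ k Δ A → (Δ + A) - (k + 1ℤ) * A ≡ Δ - k * A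
  lemma = solve-∀
excess-carry A false k Δ = refl

dsCase-excess : ∀ A .{{_ : NonZero A}} k₀ Δ₀ → excess A (dsCase A k₀ Δ₀) ≡ excess A (k₀ , Δ₀)
dsCase-excess A k₀ (+ ℕ.zero)  = refl
dsCase-excess A k₀ (+ ℕ.suc m) = begin
  excess A (dsCase A k₀ (+ ℕ.suc m))  ≡⟨ excess-borrow A (∣ + r - + A ∣ ℕ.<ᵇ r) (k₀ - + q) (+ r) ⟩
  + r - (k₀ - + q) * + A              ≡⟨ lemma (+ r) (+ q) k₀ (+ A) ⟩
  (+ r + + q * + A) - k₀ * + A        ≡⟨ cong (_- k₀ * + A) (sym (+n≡+[n%A]++[n/A]*+A (ℕ.suc m) A)) ⟩
  + ℕ.suc m - k₀ * + A                ∎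
  where
  open ≡-Reasoning
  r = ℕ.suc m % A
  q = ℕ.suc m / A
  lemma : ∀ r q k A → r - (k - q) * A ≡ (r + q * A) - k * A
  lemma = solve-∀
dsCase-excess A k₀ -[1+ m ] = begin
  excess A (dsCase A k₀ -[1+ m ])     ≡⟨ excess-carry A (∣ - + r + + A ∣ ℕ.<ᵇ ∣ - + r ∣) (k₀ + + q) (- + r) ⟩
  - + r - (k₀ + + q) * + A            ≡⟨ lemma (+ r) (+ q) k₀ (+ A) ⟩
  - (+ r + + q * + A) - k₀ * + A      ≡⟨ cong (λ n → - n - k₀ * + A) (sym (+n≡+[n%A]++[n/A]*+A (ℕ.suc m) A)) ⟩
  -[1+ m ] - k₀ * + A                 ∎
  where
  open ≡-Reasoning
  r = ℕ.suc m % A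
  q = ℕ.suc m / A
  lemma : ∀ r q k A → - r - (k + q) * A ≡ - (r + q * A) - k * A
  lemma = solve-∀

ds-excess : ∀ i D A .{{_ : NonZero A}} k₀ Δ₋ → excess A (ds i D A k₀ Δ₋) ≡ Δ₋ - + i * + D
ds-excess i D A k₀ Δ₋ =
  trans (dsCase-excess A k₀ ((k₀ - + i) * + A + + i * (+ A - + D) + Δ₋)) (lemma k₀ (+ i) (+ A) (+ D) Δ₋)
  where
  lemma : ∀ k i A D Δ → ((k - i) * A + i * (A - D) + Δ) - k * A ≡ Δ - i * D
  lemma = solve-∀

dsSeq-excess : ∀ {N} D A .{{_ : NonZero A}} (is κs : Vec ℕ N) Δ →
  excess A (map₁ sumℤ (dsSeq D A is κs Δ)) ≡ Δ - + sum is * + D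
dsSeq-excess D A [] [] Δ = refl
dsSeq-excess D A (i ∷ is) (κ ∷ κs) Δ
  with ds i D A (+ κ) Δ | ds-excess i D A (+ κ) Δ
... | (j , Δ′) | first with dsSeq D A is κs Δ′ | dsSeq-excess D A is κs Δ′
...   | (js , Δ″) | rest = begin
  Δ″ - (j + sumℤ js) * + A                          ≡⟨ split Δ″ Δ′ j (sumℤ js) (+ A) ⟩
  (Δ″ - sumℤ js * + A) + (Δ′ - j * + A) - Δ′        ≡⟨ cong₂ (λ x y → x + y - Δ′) rest first ⟩
  (Δ′ - + sum is * + D) + (Δ - + i * + D) - Δ′      ≡⟨ merge Δ′ Δ (+ i) (+ sum is) (+ D) ⟩
  Δ - (+ i + + sum is) * + D                        ≡⟨ cong (λ s → Δ - s * + D) (sym (ℤₚ.pos-+ i (sum is))) ⟩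
  Δ - + (i ℕ.+ sum is) * + D                        ∎
  where
  open ≡-Reasoning
  split : ∀ Δ″ Δ′ j s A → Δ″ - (j + s) * A ≡ (Δ″ - s * A) + (Δ′ - j * A) - Δ′
  split = solve-∀
  merge : ∀ Δ′ Δ i s D → (Δ′ - s * D) + (Δ - i * D) - Δ′ ≡ Δ - (i + s) * D
  merge = solve-∀

dsSeq-centred : ∀ {N} D A .{{_ : NonZero A}} (is κs : Vec ℕ N) {Δ} →
  Centred A Δ → Centred A (proj₂ (dsSeq D A is κs Δ))
dsSeq-centred D A [] [] c = c
dsSeq-centred D A (i ∷ is) (κ ∷ κs) {Δ} _ =
  dsSeq-centred D A is κs (dsCase-centred A (+ κ) ((+ κ - + i) * + A + + i * (+ A - + D) + Δ))

centred-closest : ∀ {A} {x : ℤ} j k → Centred A (j * + A - x) → ∣ j * + A - x ∣ ≤ ∣ k * + A - x ∣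
centred-closest {A} {x} j k centred with k ℤₚ.≟ j
... | yes refl = ℕₚ.≤-refl
... | no k≢j   = ℕₚ.+-cancelʳ-≤ d d e (begin
  d ℕ.+ d                            ≡⟨ cong (d ℕ.+_) (sym (ℕₚ.+-identityʳ d)) ⟩
  2 ℕ.* d                            ≤⟨ centred ⟩
  A                                  ≤⟨ i≢j⇒n≤∣[i-j]*n∣ A k≢j ⟩
  ∣ (k - j) * + A ∣                  ≡⟨ cong ∣_∣ (lemma k j (+ A) x) ⟩
  ∣ (k * + A - x) - (j * + A - x) ∣  ≤⟨ ℤₚ.∣i-j∣≤∣i∣+∣j∣ (k * + A - x) (j * + A - x) ⟩
  e ℕ.+ d                            ∎)
  where
  open ℕₚ.≤-Reasoning
  d = ∣ j * + A - x ∣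
  e = ∣ k * + A - x ∣
  lemma : ∀ k j A x → (k - j) * A ≡ (k * A - x) - (j * A - x)
  lemma = solve-∀

centred⇒nonNeg : ∀ {A n} .{{_ : NonZero A}} j → Centred A (j * + A - + n) → Σ ℕ λ j′ → j ≡ + j′
centred⇒nonNeg (+ j′) _ = j′ , refl
centred⇒nonNeg {A} {n} -[1+ m ] centred = ⊥-elim (ℕₚ.<⇒≱ (2*m≤n⇒m<n centred) A≤∣Δ∣)
  where
  open ℕₚ.≤-Reasoning
  lemma : ∀ s A n → (- s) * A - n ≡ - (s * A + n)
  lemma = solve-∀
  A≤∣Δ∣ : A ≤ ∣ -[1+ m ] * + A - + n ∣
  A≤∣Δ∣ = begin
    A                                   ≤⟨ ℕₚ.m≤n*m A (ℕ.suc m) ⟩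
    ℕ.suc m ℕ.* A                       ≤⟨ ℕₚ.m≤m+n (ℕ.suc m ℕ.* A) n ⟩
    ℕ.suc m ℕ.* A ℕ.+ n                 ≡⟨ cong ∣_∣ (ℤₚ.pos-+ (ℕ.suc m ℕ.* A) n) ⟩
    ∣ + (ℕ.suc m ℕ.* A) + + n ∣         ≡⟨ cong (λ s → ∣ s + + n ∣) (ℤₚ.pos-* (ℕ.suc m) A) ⟩
    ∣ + ℕ.suc m * + A + + n ∣           ≡⟨ ℤₚ.∣-i∣≡∣i∣ (+ ℕ.suc m * + A + + n) ⟨
    ∣ - (+ ℕ.suc m * + A + + n) ∣       ≡⟨ cong ∣_∣ (lemma (+ ℕ.suc m) (+ A) (+ n)) ⟨
    ∣ -[1+ m ] * + A - + n ∣            ∎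

ℤ-distance⇒ℚᵘ-distance : ∀ a (j k n : ℤ) → ∣ j * + ℕ.suc a - n ∣ ≤ ∣ k * + ℕ.suc a - n ∣ →
  ℚᵘ.∣ ℚᵘ.mkℚᵘ j 0 ℚᵘ.- ℚᵘ.mkℚᵘ n a ∣ ℚᵘ.≤ ℚᵘ.∣ ℚᵘ.mkℚᵘ k 0 ℚᵘ.- ℚᵘ.mkℚᵘ n a ∣
ℤ-distance⇒ℚᵘ-distance a j k n closer =
  ℚᵘ.*≤* (ℤₚ.*-monoʳ-≤-nonNeg (+ (1 ℕ.* ℕ.suc a)) (ℤ.+≤+ closer′))
  where
  closer′ : ∣ j * + ℕ.suc a + (- n) * + 1 ∣ ≤ ∣ k * + ℕ.suc a + (- n) * + 1 ∣
  closer′ = subst (λ z → ∣ j * + ℕ.suc a + z ∣ ≤ ∣ k * + ℕ.suc a + z ∣) (sym (ℤₚ.*-identityʳ (- n))) closer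

toℚᵘ-distance-fromℚᵘ : ∀ u w → ℚ.toℚᵘ ℚ.∣ ℚ.fromℚᵘ u ℚ.- ℚ.fromℚᵘ w ∣ ℚᵘ.≃ ℚᵘ.∣ u ℚᵘ.- w ∣
toℚᵘ-distance-fromℚᵘ u w = begin-equality
  ℚ.toℚᵘ ℚ.∣ ℚ.fromℚᵘ u ℚ.- ℚ.fromℚᵘ w ∣                     ≃⟨ ℚₚ.toℚᵘ-homo-∣-∣ (ℚ.fromℚᵘ u ℚ.- ℚ.fromℚᵘ w) ⟩
  ℚᵘ.∣ ℚ.toℚᵘ (ℚ.fromℚᵘ u ℚ.- ℚ.fromℚᵘ w) ∣                  ≃⟨ ℚᵘₚ.∣-∣-cong (ℚₚ.toℚᵘ-homo-+ (ℚ.fromℚᵘ u) (ℚ.- ℚ.fromℚᵘ w)) ⟩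
  ℚᵘ.∣ ℚ.toℚᵘ (ℚ.fromℚᵘ u) ℚᵘ.+ ℚ.toℚᵘ (ℚ.- ℚ.fromℚᵘ w) ∣    ≃⟨ ℚᵘₚ.∣-∣-cong (ℚᵘₚ.+-cong (ℚₚ.toℚᵘ-fromℚᵘ u) -w) ⟩
  ℚᵘ.∣ u ℚᵘ.- w ∣                                            ∎
  where
  open ℚᵘₚ.≤-Reasoning
  -w : ℚ.toℚᵘ (ℚ.- ℚ.fromℚᵘ w) ℚᵘ.≃ ℚᵘ.- w
  -w = ℚᵘₚ.≃-trans (ℚₚ.toℚᵘ-homo‿- (ℚ.fromℚᵘ w)) (ℚᵘₚ.-‿cong (ℚₚ.toℚᵘ-fromℚᵘ w))

fromℚᵘ-distance-≤ : ∀ u v w → ℚᵘ.∣ u ℚᵘ.- w ∣ ℚᵘ.≤ ℚᵘ.∣ v ℚᵘ.- w ∣ →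
  ℚ.∣ ℚ.fromℚᵘ u ℚ.- ℚ.fromℚᵘ w ∣ ℚ.≤ ℚ.∣ ℚ.fromℚᵘ v ℚ.- ℚ.fromℚᵘ w ∣
fromℚᵘ-distance-≤ u v w closer = ℚₚ.toℚᵘ-cancel-≤ (begin
  ℚ.toℚᵘ ℚ.∣ ℚ.fromℚᵘ u ℚ.- ℚ.fromℚᵘ w ∣  ≃⟨ toℚᵘ-distance-fromℚᵘ u w ⟩
  ℚᵘ.∣ u ℚᵘ.- w ∣                         ≤⟨ closer ⟩
  ℚᵘ.∣ v ℚᵘ.- w ∣                         ≃⟨ toℚᵘ-distance-fromℚᵘ v w ⟨
  ℚ.toℚᵘ ℚ.∣ ℚ.fromℚᵘ v ℚ.- ℚ.fromℚᵘ w ∣  ∎)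
  where open ℚᵘₚ.≤-Reasoning

centred⇒nearest : ∀ i D A .{{_ : NonZero A}} j → Centred A (j * + A - + (i ℕ.* D)) →
  IsNearestIntegerSolution i D A j
-- ℕtoℚ k and ratio i D (suc a) are, by definition, fromℚᵘ (mkℚᵘ (+ k) 0) and
-- fromℚᵘ (mkℚᵘ (+ (i * D)) a).
centred⇒nearest i D (ℕ.suc a) j centred with centred⇒nonNeg j centred
... | j′ , refl = j′ , refl , λ k →
  fromℚᵘ-distance-≤ (ℚᵘ.mkℚᵘ (+ j′) 0) (ℚᵘ.mkℚᵘ (+ k) 0) (ℚᵘ.mkℚᵘ (+ (i ℕ.* D)) a)
    (ℤ-distance⇒ℚᵘ-distance a (+ j′) (+ k) (+ (i ℕ.* D)) (centred-closest (+ j′) (+ k) centred))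

theorem4 : (N : ℕ) → 1 ≤ N → (is : Vec ℕ N) (D A : ℕ) → {{_ : NonZero A}} → (κs : Vec ℕ N) →
    IsNearestIntegerSolution (sum is) D A (sumℤ (proj₁ (dsSeq D A is κs 0ℤ)))
    × (proj₂ (dsSeq D A is κs 0ℤ) ≡ sumℤ (proj₁ (dsSeq D A is κs 0ℤ)) * + A - + (sum is) * + D)
theorem4 _ _ is D A κs = centred⇒nearest (sum is) D A j centred , Δ≡jA-iD
  where
  result = dsSeq D A is κs 0ℤ
  j = sumℤ (proj₁ result)
  Δ≡jA-iD : proj₂ result ≡ j * + A - + sum is * + D
  Δ≡jA-iD = i-j≡0-k⇒i≡j-k (dsSeq-excess D A is κs 0ℤ)
  centred : Centred A (j * + A - + (sum is ℕ.* D))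
  centred = subst (Centred A) (trans Δ≡jA-iD (cong (_-_ (j * + A)) (sym (ℤₚ.pos-* (sum is) D))))
                  (dsSeq-centred D A is κs ℕ.z≤n)
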